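{- For every integer $n\ge 2$: (a) there is a graph $G$ such that $\nu(H)=n$ and $\gamma(H)=n+1$ for every $H\in\Gamma_1(G)$; (b) there is a graph $G$ such that $\nu(H)=n$ and $\gamma(H)=2n-1$ for every $H\in\Gamma_1(G)$; (c) there is a graph $G$ such that $\nu(H)=n$ and $\gamma(H)=1$ for every $H\in\Gamma_0(G)$.
   Context: A hypergraph $H$ has a finite non-empty vertex set and a collection of non-empty subsets (hyperedges); rank is the maximum hyperedge size. Two vertices are adjacent if some hyperedge contains both. $\nu(H)$ is the maximum number of pairwise disjoint hyperedges; $\gamma(H)$ is the minimum size of a set $D$ of vertices such that every vertex not in $D$ is adjacent to a vertex of $D$. Dilation of a simple graph $G$: for $k\ge 3$, assign to each vertex $v$ a positive integer $s_v$ with $s_u+s_v\le k$ for every edge $uv$; for each vertex $v$ let $\mathbf v$ be an $s_v$-set containing $v$, and for each edge $e=uv$ let $\mathbf e$ be a set of size at most $k-s_u-s_v$, all these sets pairwise disjoint. A dilation of $G$ is a hypergraph of rank $k$ with vertex set $\bigcup_v\mathbf v\cup\bigcup_e\mathbf e$ and hyperedges $\mathbf u\cup\mathbf v\cup\mathbf e$ for $e=uv\in E(G)$. $\Gamma_0(G)$ is the set of dilations with $\mathbf e=\emptyset$ for every edge, $\Gamma_1(G)$ the set of dilations with $\mathbf e\neq\emptyset$ for every edge. -}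

module Defs where

open import Data.Nat using (ℕ; suc; _+_; _∸_; _≤_)
open import Data.Fin using (Fin; _≟_)
open import Data.Fin.Subset using (Subset; _∈_; _∉_; _∩_; Empty; ∣_∣)
open import Data.Vec using (tabulate)
open import Data.Bool using (Bool; _∨_)
open import Data.Sum using (_⊎_; inj₁; inj₂)
open import Data.Product using (Σ; ∃; _×_; _,_)
open import Relation.Nullary using (¬_)
open import Relation.Nullary.Decidable using (⌊_⌋)
open import Relation.Binary.PropositionalEquality using (_≡_; _≢_)
open import Function.Bundles using (_↔_; _↣_)

record Hypergraph : Set where
  field
    V    : ℕ
    m    : ℕ
    edge : Fin m → Subset V
open Hypergraph public

Adjacent : (H : Hypergraph) → Fin (V H) → Fin (V H) → Set
Adjacent H x y = ∃ λ i → x ∈ edge H i × y ∈ edge H i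

Dominating : (H : Hypergraph) → Subset (V H) → Set
Dominating H D = ∀ x → x ∉ D → ∃ λ y → y ∈ D × Adjacent H x y

DomNumberIs : Hypergraph → ℕ → Set
DomNumberIs H g =
  (∃ λ D → Dominating H D × ∣ D ∣ ≡ g) ×
  (∀ D → Dominating H D → g ≤ ∣ D ∣)

PairwiseDisjoint : (H : Hypergraph) → Subset (m H) → Set
PairwiseDisjoint H M =
  ∀ i j → i ∈ M → j ∈ M → i ≢ j → Empty (edge H i ∩ edge H j)

MatchingNumberIs : Hypergraph → ℕ → Set
MatchingNumberIs H n =
  (∃ λ M → PairwiseDisjoint H M × ∣ M ∣ ≡ n) ×
  (∀ M → PairwiseDisjoint H M → ∣ M ∣ ≤ n)

record Graph : Set where
  field
    p   : ℕ
    q   : ℕ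
    src : Fin q → Fin p
    tgt : Fin q → Fin p
    loopless : ∀ i → src i ≢ tgt i
    simple   : ∀ i j → i ≢ j →
               ¬ ((src i ≡ src j × tgt i ≡ tgt j) ⊎ (src i ≡ tgt j × tgt i ≡ src j))
open Graph public

-- The vertex set of H is Fin N; the map `block` sends
-- each vertex of H to the block it belongs to: a vertex block 𝐯 (inj₁ v)
-- or an edge block 𝐞 (inj₂ e).  The blocks are thus pairwise disjoint and
-- cover the vertex set.

Block : ∀ {N} (G : Graph) → (Fin N → Fin (p G) ⊎ Fin (q G)) → Fin (p G) ⊎ Fin (q G) → Set
Block {N} G φ b = Σ (Fin N) λ x → φ x ≡ b

record Dilation (G : Graph) : Set where
  field
    k       : ℕ
    k≥3     : 3 ≤ k
    s       : Fin (p G) → ℕ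
    s-pos   : ∀ v → 1 ≤ s v
    s-edge  : ∀ e → s (src G e) + s (tgt G e) ≤ k
    N       : ℕ
    block   : Fin N → Fin (p G) ⊎ Fin (q G)
    vsize   : ∀ v → Block G block (inj₁ v) ↔ Fin (s v)
    esize   : ∀ e → Block G block (inj₂ e) ↣ Fin (k ∸ s (src G e) ∸ s (tgt G e))
open Dilation public

-- does a vertex lying in block b belong to the hyperedge 𝐮 ∪ 𝐯 ∪ 𝐞 of e = uv ?
inHyperedge : (G : Graph) → Fin (p G) ⊎ Fin (q G) → Fin (q G) → Bool
inHyperedge G (inj₁ v) e = ⌊ v ≟ src G e ⌋ ∨ ⌊ v ≟ tgt G e ⌋
inHyperedge G (inj₂ f) e = ⌊ f ≟ e ⌋

dilHyp : {G : Graph} → Dilation G → Hypergraph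
dilHyp {G} D = record
  { V = N D
  ; m = q G
  ; edge = λ e → tabulate λ x → inHyperedge G (block D x) e
  }

InΓ₀ : {G : Graph} → Dilation G → Set
InΓ₀ {G} D = ∀ e → ¬ Block G (block D) (inj₂ e)

InΓ₁ : {G : Graph} → Dilation G → Set
InΓ₁ {G} D = ∀ e → Block G (block D) (inj₂ e)

-- In a dilation H of G, two hyperedges meet exactly when the corresponding edges of G share
-- an endpoint, so ν(H) = ν(G).  If every edge block is non-empty, a point of the block of e
-- lies in no other hyperedge, so a dominating set of H meets every hyperedge; sending each
-- of its points to a graph vertex (itself, or an endpoint of its edge) yields a vertex cover
-- of G, so γ(H) = τ(G) when G has no isolated vertex.  For t triangles and u disjoint edges,
-- ν = t + u and τ = 2t + u, giving (a) with t = 1 and (b) with u = 1.  If every edge block is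
-- empty, any point of the centre block of the windmill of n triangles dominates H, while ν = n.

module Submission where

open import Defs
open import Data.Bool using (Bool; T)
open import Data.Bool.Properties using (T-≡; T-∨)
open import Data.Empty using (⊥-elim)
open import Data.Fin using (Fin; zero; suc; _≟_; fromℕ<; inject₁)
open import Data.Fin.Properties using (injective⇒≤; any?; suc-injective; +↔⊎; *↔×; inject₁-injective)
open import Data.Fin.Subset using (Subset; _∈_; ⊤; ⁅_⁆; ∣_∣; inside; outside)
open import Data.Fin.Subset.Properties
  using (∈⊤; ∣⊤∣≡n; _∈?_; x∈⁅x⁆; ∣⁅x⁆∣≡1; x∈p∩q⁺; x∈p∩q⁻; x∈p⇒∣p-x∣<∣p∣)
open import Data.Nat using (ℕ; zero; suc; _+_; _*_; _∸_; _≤_; z≤n; s≤s)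
open import Data.Nat.Properties using (≤-trans; ≤-antisym; +-comm; *-comm; *-suc)
open import Data.Product using (∃; _×_; _,_; proj₁; proj₂)
import Data.Product as Product
open import Data.Product.Properties using (,-injectiveˡ; ,-injectiveʳ)
open import Data.Sum using (_⊎_; inj₁; inj₂; [_,_]′)
import Data.Sum as Sum
open import Data.Sum.Function.Propositional using (_⊎-↔_)
open import Data.Sum.Properties using (inj₁-injective; inj₂-injective)
open import Data.Vec using (_∷_; tabulate; here; there)
open import Data.Vec.Properties using ([]=⇒lookup; lookup⇒[]=; lookup∘tabulate)
open import Function.Base using (_∘_; id)
open import Function.Bundles using (Equivalence; _⇔_; mk⇔; Inverse; _↔_; Injection)
open import Function.Definitions using (Injective)
open import Function.Properties.Inverse using (↔⇒↣; ↔-sym; ↔-trans; ↔-refl)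
open import Relation.Binary.PropositionalEquality
  using (_≡_; _≢_; refl; sym; trans; cong; cong₂; subst; subst₂; module ≡-Reasoning)
open import Relation.Nullary using (¬_; yes; no)
open import Relation.Nullary.Decidable using (⌊_⌋; _×-dec_; toWitness; fromWitness)

private variable
  n r : ℕ
  A B : Set

∈-tabulate⁺ : (f : Fin n → Bool) {x : Fin n} → T (f x) → x ∈ tabulate f
∈-tabulate⁺ f {x} fx = lookup⇒[]= x (tabulate f) (trans (lookup∘tabulate f x) (Equivalence.to T-≡ fx))

∈-tabulate⁻ : (f : Fin n → Bool) {x : Fin n} → x ∈ tabulate f → T (f x)
∈-tabulate⁻ f {x} x∈ = Equivalence.from T-≡ (trans (sym (lookup∘tabulate f x)) ([]=⇒lookup x∈))

enumerate : (P : Subset n) → Fin ∣ P ∣ → Fin n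
enumerate (outside ∷ P) i       = suc (enumerate P i)
enumerate (inside  ∷ P) zero    = zero
enumerate (inside  ∷ P) (suc i) = suc (enumerate P i)

enumerate-injective : (P : Subset n) → Injective _≡_ _≡_ (enumerate P)
enumerate-injective (outside ∷ P) eq = enumerate-injective P (suc-injective eq)
enumerate-injective (inside  ∷ P) {zero}  {zero}  _  = refl
enumerate-injective (inside  ∷ P) {suc i} {suc j} eq = cong suc (enumerate-injective P (suc-injective eq))

enumerate-∈ : (P : Subset n) (i : Fin ∣ P ∣) → enumerate P i ∈ P
enumerate-∈ (outside ∷ P) i       = there (enumerate-∈ P i)
enumerate-∈ (inside  ∷ P) zero    = here
enumerate-∈ (inside  ∷ P) (suc i) = there (enumerate-∈ P i)

∈⇒enumerated : (P : Subset n) {x : Fin n} → x ∈ P → ∃ λ i → enumerate P i ≡ x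
∈⇒enumerated (outside ∷ P) (there x∈) = let i , eq = ∈⇒enumerated P x∈ in i , cong suc eq
∈⇒enumerated (inside  ∷ P) here       = zero , refl
∈⇒enumerated (inside  ∷ P) (there x∈) = let i , eq = ∈⇒enumerated P x∈ in suc i , cong suc eq

injectiveOn⇒∣P∣≤ : (P : Subset n) (f : ∀ x → x ∈ P → Fin r) →
                   (∀ {x y} x∈ y∈ → f x x∈ ≡ f y y∈ → x ≡ y) → ∣ P ∣ ≤ r
injectiveOn⇒∣P∣≤ P f f-inj = injective⇒≤ {f = λ i → f (enumerate P i) (enumerate-∈ P i)}
  (enumerate-injective P ∘ f-inj (enumerate-∈ P _) (enumerate-∈ P _))

injective⇒≤∣P∣ : (P : Subset n) (f : Fin r → Fin n) → Injective _≡_ _≡_ f → (∀ i → f i ∈ P) → r ≤ ∣ P ∣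
injective⇒≤∣P∣ P f f-inj f∈P = injective⇒≤ {f = index} λ {i} {j} eq → f-inj (begin
  f i                   ≡⟨ sym (index-correct i) ⟩
  enumerate P (index i) ≡⟨ cong (enumerate P) eq ⟩
  enumerate P (index j) ≡⟨ index-correct j ⟩
  f j                   ∎)
  where
  open ≡-Reasoning

  index : Fin _ → Fin ∣ P ∣
  index i = proj₁ (∈⇒enumerated P (f∈P i))

  index-correct : ∀ i → enumerate P (index i) ≡ f i
  index-correct i = proj₂ (∈⇒enumerated P (f∈P i))

image : (Fin r → Fin n) → Subset r → Subset n
image f P = tabulate λ y → ⌊ any? (λ x → x ∈? P ×-dec f x ≟ y) ⌋

∈-image⁺ : (f : Fin r → Fin n) (P : Subset r) {x : Fin r} → x ∈ P → f x ∈ image f P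
∈-image⁺ f P {x} x∈ = ∈-tabulate⁺ _ (fromWitness (x , x∈ , refl))

∈-image⁻ : (f : Fin r → Fin n) (P : Subset r) {y : Fin n} → y ∈ image f P → ∃ λ x → x ∈ P × f x ≡ y
∈-image⁻ f P y∈ = toWitness (∈-tabulate⁻ _ y∈)

∣image∣≤∣P∣ : (f : Fin r → Fin n) (P : Subset r) → ∣ image f P ∣ ≤ ∣ P ∣
∣image∣≤∣P∣ f P = injectiveOn⇒∣P∣≤ (image f P) index index-injective
  where
  index : ∀ y → y ∈ image f P → Fin ∣ P ∣
  index y y∈ = let x , x∈ , _ = ∈-image⁻ f P y∈ in proj₁ (∈⇒enumerated P x∈)

  index-injective : ∀ {y y′} y∈ y′∈ → index y y∈ ≡ index y′ y′∈ → y ≡ y′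
  index-injective y∈ y′∈ eq
    with ∈-image⁻ f P y∈ | ∈-image⁻ f P y′∈
  ... | x , x∈ , refl | x′ , x′∈ , refl
    with ∈⇒enumerated P x∈ | ∈⇒enumerated P x′∈
  ... | _ , refl | _ , refl = cong (f ∘ enumerate P) eq

∣image∣≡∣P∣ : (f : Fin r → Fin n) → Injective _≡_ _≡_ f → (P : Subset r) → ∣ image f P ∣ ≡ ∣ P ∣
∣image∣≡∣P∣ f f-inj P = ≤-antisym (∣image∣≤∣P∣ f P)
  (injective⇒≤∣P∣ (image f P) (f ∘ enumerate P) (enumerate-injective P ∘ f-inj) (∈-image⁺ f P ∘ enumerate-∈ P))

x∈P⇒1≤∣P∣ : {P : Subset n} {x : Fin n} → x ∈ P → 1 ≤ ∣ P ∣
x∈P⇒1≤∣P∣ x∈ = ≤-trans (s≤s z≤n) (x∈p⇒∣p-x∣<∣p∣ x∈)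

Hitting : (H : Hypergraph) → Subset (V H) → Set
Hitting H S = ∀ i → ∃ λ x → x ∈ S × x ∈ edge H i

hitting⇒dominating : (H : Hypergraph) {S : Subset (V H)} →
  (∀ x → ∃ λ i → x ∈ edge H i) → Hitting H S → Dominating H S
hitting⇒dominating H covered hit x _ =
  let i , x∈i = covered x
      y , y∈S , y∈i = hit i
  in y , y∈S , i , x∈i , y∈i

dominating⇒1≤∣S∣ : (H : Hypergraph) {S : Subset (V H)} → Fin (V H) → Dominating H S → 1 ≤ ∣ S ∣
dominating⇒1≤∣S∣ H {S} x dom with x ∈? S
... | yes x∈S = x∈P⇒1≤∣P∣ x∈S
... | no  x∉S = x∈P⇒1≤∣P∣ (proj₁ (proj₂ (dom x x∉S)))

module _ (G : Graph) where

  IsEnd : Fin (p G) → Fin (q G) → Set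
  IsEnd v e = v ≡ src G e ⊎ v ≡ tgt G e

  ShareEnd : Fin (q G) → Fin (q G) → Set
  ShareEnd e f = ∃ λ v → IsEnd v e × IsEnd v f

  IsMatching : Subset (q G) → Set
  IsMatching M = ∀ e f → e ∈ M → f ∈ M → e ≢ f → ¬ ShareEnd e f

  GraphMatchingNumberIs : ℕ → Set
  GraphMatchingNumberIs n =
    (∃ λ M → IsMatching M × ∣ M ∣ ≡ n) × (∀ M → IsMatching M → ∣ M ∣ ≤ n)

  IsVertexCover : Subset (p G) → Set
  IsVertexCover C = ∀ e → ∃ λ v → v ∈ C × IsEnd v e

  VertexCoverNumberIs : ℕ → Set
  VertexCoverNumberIs g =
    (∃ λ C → IsVertexCover C × ∣ C ∣ ≡ g) × (∀ C → IsVertexCover C → g ≤ ∣ C ∣)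

  Incident : Fin (p G) ⊎ Fin (q G) → Fin (q G) → Set
  Incident (inj₁ v) e = IsEnd v e
  Incident (inj₂ f) e = f ≡ e

  T-inHyperedge⇔Incident : ∀ b e → T (inHyperedge G b e) ⇔ Incident b e
  T-inHyperedge⇔Incident (inj₁ v) e = mk⇔
    (Sum.map (toWitness {a? = v ≟ src G e}) (toWitness {a? = v ≟ tgt G e}) ∘ Equivalence.to T-∨)
    (Equivalence.from T-∨ ∘ Sum.map (fromWitness {a? = v ≟ src G e}) (fromWitness {a? = v ≟ tgt G e}))
  T-inHyperedge⇔Incident (inj₂ f) e = mk⇔ toWitness fromWitness

  incident-twice⇒ShareEnd : ∀ {e f} → e ≢ f → ∀ b → Incident b e → Incident b f → ShareEnd e f
  incident-twice⇒ShareEnd e≢f (inj₁ v) v-e v-f = v , v-e , v-f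
  incident-twice⇒ShareEnd e≢f (inj₂ _) refl refl = ⊥-elim (e≢f refl)

  -- A point of an edge block is sent to the source of its edge; either end would do.
  anchorOf : Fin (p G) ⊎ Fin (q G) → Fin (p G)
  anchorOf = [ id , src G ]′

  incident⇒anchorOf-IsEnd : ∀ b e → Incident b e → IsEnd (anchorOf b) e
  incident⇒anchorOf-IsEnd (inj₁ v) e v-e  = v-e
  incident⇒anchorOf-IsEnd (inj₂ f) e refl = inj₁ refl

module _ {G : Graph} (D : Dilation G) where

  private
    H : Hypergraph
    H = dilHyp D

  ∈-dilHyp⁻ : ∀ {x e} → x ∈ edge H e → Incident G (block D x) e
  ∈-dilHyp⁻ {x} {e} = Equivalence.to (T-inHyperedge⇔Incident G (block D x) e) ∘ ∈-tabulate⁻ _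

  ∈-dilHyp⁺ : ∀ {x b e} → block D x ≡ b → Incident G b e → x ∈ edge H e
  ∈-dilHyp⁺ {x} {b} {e} refl = ∈-tabulate⁺ _ ∘ Equivalence.from (T-inHyperedge⇔Incident G b e)

  vertexRep : Fin (p G) → Fin (N D)
  vertexRep v = proj₁ (Inverse.from (vsize D v) (fromℕ< (s-pos D v)))

  block-vertexRep : ∀ v → block D (vertexRep v) ≡ inj₁ v
  block-vertexRep v = proj₂ (Inverse.from (vsize D v) (fromℕ< (s-pos D v)))

  vertexRep-injective : Injective _≡_ _≡_ vertexRep
  vertexRep-injective {u} {v} eq =
    inj₁-injective (trans (sym (block-vertexRep u)) (trans (cong (block D) eq) (block-vertexRep v)))

  vertexRep-∈ : ∀ {v e} → IsEnd G v e → vertexRep v ∈ edge H e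
  vertexRep-∈ {v} = ∈-dilHyp⁺ (block-vertexRep v)

  anchor : Fin (N D) → Fin (p G)
  anchor x = anchorOf G (block D x)

  anchor-IsEnd : ∀ {x e} → x ∈ edge H e → IsEnd G (anchor x) e
  anchor-IsEnd x∈e = incident⇒anchorOf-IsEnd G _ _ (∈-dilHyp⁻ x∈e)

  pairwiseDisjoint⇔IsMatching : ∀ M → PairwiseDisjoint H M ⇔ IsMatching G M
  pairwiseDisjoint⇔IsMatching M = mk⇔
    (λ disjoint e f e∈ f∈ e≢f (v , v-e , v-f) →
       disjoint e f e∈ f∈ e≢f (vertexRep v , x∈p∩q⁺ (vertexRep-∈ v-e , vertexRep-∈ v-f)))
    (λ matching e f e∈ f∈ e≢f (x , x∈e∩f) →
       let x∈e , x∈f = x∈p∩q⁻ (edge H e) (edge H f) x∈e∩f in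
       matching e f e∈ f∈ e≢f (incident-twice⇒ShareEnd G e≢f (block D x)
         (∈-dilHyp⁻ x∈e) (∈-dilHyp⁻ x∈f)))

  matchingNumber-dilHyp : ∀ {n} → GraphMatchingNumberIs G n → MatchingNumberIs H n
  matchingNumber-dilHyp ((M , matching , ∣M∣≡n) , maximal) =
    (M , Equivalence.from (pairwiseDisjoint⇔IsMatching M) matching , ∣M∣≡n) ,
    λ M′ disjoint → maximal M′ (Equivalence.to (pairwiseDisjoint⇔IsMatching M′) disjoint)

  vertexCover⇒hitting : ∀ {C} → IsVertexCover G C → Hitting H (image vertexRep C)
  vertexCover⇒hitting cover e =
    let v , v∈C , v-e = cover e in vertexRep v , ∈-image⁺ vertexRep _ v∈C , vertexRep-∈ v-e

  hitting⇒vertexCover : ∀ {S} → Hitting H S → IsVertexCover G (image anchor S)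
  hitting⇒vertexCover hit e =
    let x , x∈S , x∈e = hit e in anchor x , ∈-image⁺ anchor _ x∈S , anchor-IsEnd x∈e

  -- The point of the block of e lies only in the hyperedge of e, so it is dominated there.
  dominating⇒hitting : InΓ₁ D → ∀ {S} → Dominating H S → Hitting H S
  dominating⇒hitting Γ₁ {S} dom e with Γ₁ e
  ... | x , bx with x ∈? S
  ...   | yes x∈S = x , x∈S , ∈-dilHyp⁺ bx refl
  ...   | no  x∉S =
    let y , y∈S , f , x∈f , y∈f = dom x x∉S
        e≡f = subst (λ b → Incident G b f) bx (∈-dilHyp⁻ x∈f)
    in y , y∈S , subst (λ e′ → y ∈ edge H e′) (sym e≡f) y∈f

  liesInHyperedge : (∀ v → ∃ λ e → IsEnd G v e) → ∀ x → ∃ λ e → x ∈ edge H e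
  liesInHyperedge noIsolated x = go (block D x) refl
    where
    go : ∀ b → block D x ≡ b → ∃ λ e → x ∈ edge H e
    go (inj₁ v) bx = let e , v-e = noIsolated v in e , ∈-dilHyp⁺ bx v-e
    go (inj₂ e) bx = e , ∈-dilHyp⁺ bx refl

  domNumber-dilHyp-Γ₁ : ∀ {g} → (∀ v → ∃ λ e → IsEnd G v e) → VertexCoverNumberIs G g →
                        InΓ₁ D → DomNumberIs H g
  domNumber-dilHyp-Γ₁ noIsolated ((C , cover , ∣C∣≡g) , minimal) Γ₁ =
    (image vertexRep C ,
     hitting⇒dominating H (liesInHyperedge noIsolated) (vertexCover⇒hitting cover) ,
     trans (∣image∣≡∣P∣ vertexRep vertexRep-injective C) ∣C∣≡g) ,
    λ S dom → ≤-trans (minimal _ (hitting⇒vertexCover (dominating⇒hitting Γ₁ dom))) (∣image∣≤∣P∣ anchor S)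

  domNumber-dilHyp-Γ₀ : (c : Fin (p G)) → (∀ v → ∃ λ e → IsEnd G c e × IsEnd G v e) →
                        InΓ₀ D → DomNumberIs H 1
  domNumber-dilHyp-Γ₀ c universal Γ₀ =
    (⁅ vertexRep c ⁆ , dominated , ∣⁅x⁆∣≡1 (vertexRep c)) ,
    λ S dom → dominating⇒1≤∣S∣ H (vertexRep c) dom
    where
    dominated : Dominating H ⁅ vertexRep c ⁆
    dominated x _ = go (block D x) refl
      where
      go : ∀ b → block D x ≡ b → ∃ λ y → y ∈ ⁅ vertexRep c ⁆ × Adjacent H x y
      go (inj₁ v) bx = let e , c-e , v-e = universal v in
        vertexRep c , x∈⁅x⁆ _ , e , ∈-dilHyp⁺ bx v-e , vertexRep-∈ c-e
      go (inj₂ e) bx = ⊥-elim (Γ₀ e (x , bx))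

to-injective : (I : A ↔ B) → Injective _≡_ _≡_ (Inverse.to I)
to-injective I = Injection.injective (↔⇒↣ I)

from-injective : (I : A ↔ B) → Injective _≡_ _≡_ (Inverse.from I)
from-injective I = to-injective (↔-sym I)

distinctEnds-byDecoder : (source target : B → A) (between : A → A → B) →
  (∀ e → between (source e) (target e) ≡ e) → (∀ e → between (target e) (source e) ≡ e) →
  ∀ e f → e ≢ f →
  ¬ ((source e ≡ source f × target e ≡ target f) ⊎ (source e ≡ target f × target e ≡ source f))
distinctEnds-byDecoder source target between forward backward e f e≢f (inj₁ (s≡s , t≡t)) =
  e≢f (trans (sym (forward e)) (trans (cong₂ between s≡s t≡t) (forward f)))
distinctEnds-byDecoder source target between forward backward e f e≢f (inj₂ (s≡t , t≡s)) =
  e≢f (trans (sym (forward e)) (trans (cong₂ between s≡t t≡s) (backward f)))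

record Presentation : Set₁ where
  field
    Vertex Edge      : Set
    #vertices #edges : ℕ
    enumVertex       : Fin #vertices ↔ Vertex
    enumEdge         : Fin #edges ↔ Edge
    source target    : Edge → Vertex
    source≢target    : ∀ e → source e ≢ target e
    distinctEnds     : ∀ e f → e ≢ f →
      ¬ ((source e ≡ source f × target e ≡ target f) ⊎ (source e ≡ target f × target e ≡ source f))

  Ends : Vertex → Edge → Set
  Ends w e = w ≡ source e ⊎ w ≡ target e

  Meet : Edge → Edge → Set
  Meet e f = ∃ λ w → Ends w e × Ends w f

  vertexAt : Fin #vertices → Vertex
  vertexAt = Inverse.to enumVertex

  vertexIndex : Vertex → Fin #vertices
  vertexIndex = Inverse.from enumVertex

  edgeAt : Fin #edges → Edge
  edgeAt = Inverse.to enumEdge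

  edgeIndex : Edge → Fin #edges
  edgeIndex = Inverse.from enumEdge

  graph : Graph
  graph = record
    { p        = #vertices
    ; q        = #edges
    ; src      = vertexIndex ∘ source ∘ edgeAt
    ; tgt      = vertexIndex ∘ target ∘ edgeAt
    ; loopless = λ i → source≢target (edgeAt i) ∘ from-injective enumVertex
    ; simple   = λ i j i≢j → distinctEnds (edgeAt i) (edgeAt j) (i≢j ∘ to-injective enumEdge) ∘
        Sum.map (Product.map (from-injective enumVertex) (from-injective enumVertex))
                (Product.map (from-injective enumVertex) (from-injective enumVertex))
    }

module _ (P : Presentation) where
  open Presentation P

  IsEnd⇒Ends : ∀ {v i} → IsEnd graph v i → Ends (vertexAt v) (edgeAt i)
  IsEnd⇒Ends (inj₁ eq) = inj₁ (trans (cong vertexAt eq) (Inverse.strictlyInverseˡ enumVertex _))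
  IsEnd⇒Ends (inj₂ eq) = inj₂ (trans (cong vertexAt eq) (Inverse.strictlyInverseˡ enumVertex _))

  Ends⇒IsEnd : ∀ {w i} → Ends w (edgeAt i) → IsEnd graph (vertexIndex w) i
  Ends⇒IsEnd = Sum.map (cong vertexIndex) (cong vertexIndex)

  Ends⇒IsEnd-index : ∀ {w e} → Ends w e → IsEnd graph (vertexIndex w) (edgeIndex e)
  Ends⇒IsEnd-index {e = e} = Ends⇒IsEnd ∘ subst (Ends _) (sym (Inverse.strictlyInverseˡ enumEdge e))

  Ends-vertexAt⇒IsEnd : ∀ {v e} → Ends (vertexAt v) e → IsEnd graph v (edgeIndex e)
  Ends-vertexAt⇒IsEnd {v} {e} =
    subst (λ u → IsEnd graph u (edgeIndex e)) (Inverse.strictlyInverseʳ enumVertex v) ∘ Ends⇒IsEnd-index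

  ShareEnd⇒Meet : ∀ {i j} → ShareEnd graph i j → Meet (edgeAt i) (edgeAt j)
  ShareEnd⇒Meet (v , v-i , v-j) = vertexAt v , IsEnd⇒Ends v-i , IsEnd⇒Ends v-j

  Meet⇒ShareEnd : ∀ {i j} → Meet (edgeAt i) (edgeAt j) → ShareEnd graph i j
  Meet⇒ShareEnd (w , w-i , w-j) = vertexIndex w , Ends⇒IsEnd w-i , Ends⇒IsEnd w-j

  -- Edges of one class pairwise meet, so a matching has at most one edge per class,
  -- while the picked edges form a matching with one edge in every class.
  matchingNumber : ∀ {n} (Class : Set) (enumClass : Fin n ↔ Class)
    (class : Edge → Class) (pick : Class → Edge) → (∀ c → class (pick c) ≡ c) →
    (∀ e f → class e ≡ class f → e ≢ f → Meet e f) →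
    (∀ c d → c ≢ d → ¬ Meet (pick c) (pick d)) →
    GraphMatchingNumberIs graph n
  matchingNumber {n} Class enumClass class pick class-pick clique apart =
    (image pickIndex ⊤ , picks-matching , trans (∣image∣≡∣P∣ pickIndex pickIndex-injective ⊤) (∣⊤∣≡n n)) ,
    λ M matching → injectiveOn⇒∣P∣≤ M (λ i _ → classIndex i) (classIndex-injective matching)
    where
    pickIndex : Fin n → Fin #edges
    pickIndex = edgeIndex ∘ pick ∘ Inverse.to enumClass

    pickIndex-injective : Injective _≡_ _≡_ pickIndex
    pickIndex-injective eq = to-injective enumClass
      (trans (sym (class-pick _)) (trans (cong class (from-injective enumEdge eq)) (class-pick _)))

    picks-matching : IsMatching graph (image pickIndex ⊤)
    picks-matching i j i∈ j∈ i≢j shared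
      with ∈-image⁻ pickIndex ⊤ i∈ | ∈-image⁻ pickIndex ⊤ j∈
    ... | a , _ , refl | b , _ , refl =
      apart _ _ (i≢j ∘ cong pickIndex ∘ to-injective enumClass)
        (subst₂ Meet (Inverse.strictlyInverseˡ enumEdge _) (Inverse.strictlyInverseˡ enumEdge _)
          (ShareEnd⇒Meet shared))

    classIndex : Fin #edges → Fin n
    classIndex = Inverse.from enumClass ∘ class ∘ edgeAt

    classIndex-injective : ∀ {M} → IsMatching graph M → ∀ {i j} → i ∈ M → j ∈ M →
                           classIndex i ≡ classIndex j → i ≡ j
    classIndex-injective matching {i} {j} i∈ j∈ eq with i ≟ j
    ... | yes i≡j = i≡j
    ... | no  i≢j = ⊥-elim (matching i j i∈ j∈ i≢j (Meet⇒ShareEnd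
          (clique _ _ (from-injective enumClass eq) (i≢j ∘ to-injective enumEdge))))

  vertexCoverNumber : ∀ {g} (Index : Set) (enumIndex : Fin g ↔ Index) (cover : Index → Vertex) →
    Injective _≡_ _≡_ cover → (∀ e → ∃ λ c → Ends (cover c) e) →
    (∀ (C : Vertex → Set) → (∀ e → ∃ λ w → C w × Ends w e) →
       ∃ λ (f : Index → Vertex) → Injective _≡_ _≡_ f × ∀ c → C (f c)) →
    VertexCoverNumberIs graph g
  vertexCoverNumber {g} Index enumIndex cover cover-injective covers minimal =
    (image coverIndex ⊤ , coverIndex-covers ,
     trans (∣image∣≡∣P∣ coverIndex coverIndex-injective ⊤) (∣⊤∣≡n g)) ,
    λ C C-cover →
      let f , f-injective , f∈C = minimal (λ w → vertexIndex w ∈ C) (pullback C-cover)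
      in injective⇒≤∣P∣ C (vertexIndex ∘ f ∘ Inverse.to enumIndex)
           (to-injective enumIndex ∘ f-injective ∘ from-injective enumVertex) (f∈C ∘ Inverse.to enumIndex)
    where
    coverIndex : Fin g → Fin #vertices
    coverIndex = vertexIndex ∘ cover ∘ Inverse.to enumIndex

    coverIndex-injective : Injective _≡_ _≡_ coverIndex
    coverIndex-injective = to-injective enumIndex ∘ cover-injective ∘ from-injective enumVertex

    coverIndex-covers : IsVertexCover graph (image coverIndex ⊤)
    coverIndex-covers i =
      let c , c-i = covers (edgeAt i) in
      coverIndex (Inverse.from enumIndex c) , ∈-image⁺ coverIndex ⊤ ∈⊤ ,
      subst (λ c → IsEnd graph (vertexIndex (cover c)) i) (sym (Inverse.strictlyInverseˡ enumIndex c))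
        (Ends⇒IsEnd c-i)

    pullback : ∀ {C} → IsVertexCover graph C → ∀ e → ∃ λ w → vertexIndex w ∈ C × Ends w e
    pullback {C} C-cover e =
      let v , v∈C , v-e = C-cover (edgeIndex e) in
      vertexAt v , subst (_∈ C) (sym (Inverse.strictlyInverseʳ enumVertex v)) v∈C ,
      subst (Ends (vertexAt v)) (Inverse.strictlyInverseˡ enumEdge e) (IsEnd⇒Ends v-e)

  noIsolatedVertex : (∀ w → ∃ λ e → Ends w e) → ∀ v → ∃ λ i → IsEnd graph v i
  noIsolatedVertex incident v =
    let e , v-e = incident (vertexAt v) in
    edgeIndex e , Ends-vertexAt⇒IsEnd v-e

  universalVertex : (c : Vertex) → (∀ w → ∃ λ e → Ends c e × Ends w e) →
                    ∀ v → ∃ λ i → IsEnd graph (vertexIndex c) i × IsEnd graph v i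
  universalVertex c universal v =
    let e , c-e , v-e = universal (vertexAt v) in
    edgeIndex e , Ends⇒IsEnd-index c-e , Ends-vertexAt⇒IsEnd v-e

-- Triangles and disjoint edges

module TrianglesAndEdges (t u : ℕ) where

  Vertex : Set
  Vertex = (Fin t × Fin 3) ⊎ (Fin u × Fin 2)

  Edge : Set
  Edge = (Fin t × Fin 3) ⊎ Fin u

  next : Fin 3 → Fin 3
  next zero             = suc zero
  next (suc zero)       = suc (suc zero)
  next (suc (suc zero)) = zero

  source target : Edge → Vertex
  source (inj₁ (i , k)) = inj₁ (i , k)
  source (inj₂ j)       = inj₂ (j , zero)
  target (inj₁ (i , k)) = inj₁ (i , next k)
  target (inj₂ j)       = inj₂ (j , suc zero)

  side : Fin 3 → Fin 3 → Fin 3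
  side k k′ with k′ ≟ next k
  ... | yes _ = k
  ... | no  _ = k′

  -- Only its values on the two ends of an edge matter.
  between : Vertex → Vertex → Edge
  between (inj₁ (i , k)) (inj₁ (_ , k′)) = inj₁ (i , side k k′)
  between (inj₁ (i , k)) (inj₂ _)        = inj₁ (i , k)
  between (inj₂ (j , _)) _               = inj₂ j

  between-source-target : ∀ e → between (source e) (target e) ≡ e
  between-source-target (inj₁ (i , k)) with next k ≟ next k
  ... | yes _   = refl
  ... | no  k≢k = ⊥-elim (k≢k refl)
  between-source-target (inj₂ j) = refl

  between-target-source : ∀ e → between (target e) (source e) ≡ e
  between-target-source (inj₁ (_ , zero))           = refl
  between-target-source (inj₁ (_ , suc zero))       = refl
  between-target-source (inj₁ (_ , suc (suc zero))) = refl
  between-target-source (inj₂ _)                    = refl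

  presentation : Presentation
  presentation = record
    { Vertex        = Vertex
    ; Edge          = Edge
    ; enumVertex    = ↔-trans +↔⊎ (*↔× ⊎-↔ *↔×)
    ; enumEdge      = ↔-trans +↔⊎ (*↔× ⊎-↔ ↔-refl)
    ; source        = source
    ; target        = target
    ; source≢target = λ where
        (inj₁ (_ , zero)) ()
        (inj₁ (_ , suc zero)) ()
        (inj₁ (_ , suc (suc zero))) ()
        (inj₂ _) ()
    ; distinctEnds  = distinctEnds-byDecoder source target between between-source-target between-target-source
    }

  open Presentation presentation public using (graph)
  open Presentation presentation using (Ends; Meet)

  Component : Set
  Component = Fin t ⊎ Fin u

  componentOfVertex : Vertex → Component
  componentOfVertex = Sum.map proj₁ proj₁

  componentOfEdge : Edge → Component
  componentOfEdge = Sum.map proj₁ id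

  Ends⇒sameComponent : ∀ {w e} → Ends w e → componentOfVertex w ≡ componentOfEdge e
  Ends⇒sameComponent {e = inj₁ _} (inj₁ refl) = refl
  Ends⇒sameComponent {e = inj₁ _} (inj₂ refl) = refl
  Ends⇒sameComponent {e = inj₂ _} (inj₁ refl) = refl
  Ends⇒sameComponent {e = inj₂ _} (inj₂ refl) = refl

  pick : Component → Edge
  pick (inj₁ i) = inj₁ (i , zero)
  pick (inj₂ j) = inj₂ j

  componentOfEdge-pick : ∀ c → componentOfEdge (pick c) ≡ c
  componentOfEdge-pick (inj₁ _) = refl
  componentOfEdge-pick (inj₂ _) = refl

  sameComponent⇒Meet : ∀ e f → componentOfEdge e ≡ componentOfEdge f → e ≢ f → Meet e f
  sameComponent⇒Meet (inj₁ (_ , zero))           (inj₁ (_ , zero))           refl e≢f = ⊥-elim (e≢f refl)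
  sameComponent⇒Meet (inj₁ (_ , suc zero))       (inj₁ (_ , suc zero))       refl e≢f = ⊥-elim (e≢f refl)
  sameComponent⇒Meet (inj₁ (_ , suc (suc zero))) (inj₁ (_ , suc (suc zero))) refl e≢f = ⊥-elim (e≢f refl)
  sameComponent⇒Meet (inj₁ (_ , zero))           (inj₁ (_ , suc zero))       refl _ = _ , inj₂ refl , inj₁ refl
  sameComponent⇒Meet (inj₁ (_ , suc zero))       (inj₁ (_ , zero))           refl _ = _ , inj₁ refl , inj₂ refl
  sameComponent⇒Meet (inj₁ (_ , suc zero))       (inj₁ (_ , suc (suc zero))) refl _ = _ , inj₂ refl , inj₁ refl
  sameComponent⇒Meet (inj₁ (_ , suc (suc zero))) (inj₁ (_ , suc zero))       refl _ = _ , inj₁ refl , inj₂ refl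
  sameComponent⇒Meet (inj₁ (_ , suc (suc zero))) (inj₁ (_ , zero))           refl _ = _ , inj₂ refl , inj₁ refl
  sameComponent⇒Meet (inj₁ (_ , zero))           (inj₁ (_ , suc (suc zero))) refl _ = _ , inj₁ refl , inj₂ refl
  sameComponent⇒Meet (inj₂ _)                    (inj₂ _)                    refl e≢f = ⊥-elim (e≢f refl)

  picks-apart : ∀ c d → c ≢ d → ¬ Meet (pick c) (pick d)
  picks-apart c d c≢d (w , w-c , w-d) = c≢d (begin
    c                        ≡⟨ sym (componentOfEdge-pick c) ⟩
    componentOfEdge (pick c) ≡⟨ sym (Ends⇒sameComponent w-c) ⟩
    componentOfVertex w      ≡⟨ Ends⇒sameComponent w-d ⟩
    componentOfEdge (pick d) ≡⟨ componentOfEdge-pick d ⟩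
    d                        ∎)
    where open ≡-Reasoning

  matchingNumber-graph : GraphMatchingNumberIs graph (t + u)
  matchingNumber-graph =
    matchingNumber presentation Component +↔⊎ componentOfEdge pick componentOfEdge-pick
      sameComponent⇒Meet picks-apart

  CoverIndex : Set
  CoverIndex = (Fin t × Fin 2) ⊎ Fin u

  cover : CoverIndex → Vertex
  cover (inj₁ (i , k)) = inj₁ (i , inject₁ k)
  cover (inj₂ j)       = inj₂ (j , zero)

  cover-injective : Injective _≡_ _≡_ cover
  cover-injective {inj₁ (i , k)} {inj₁ (i′ , k′)} eq
    with refl ← ,-injectiveˡ (inj₁-injective eq) =
    cong (λ k → inj₁ (i , k)) (inject₁-injective (,-injectiveʳ (inj₁-injective eq)))
  cover-injective {inj₂ j} {inj₂ j′} eq = cong inj₂ (,-injectiveˡ (inj₂-injective eq))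

  cover-covers : ∀ e → ∃ λ c → Ends (cover c) e
  cover-covers (inj₁ (i , zero))           = inj₁ (i , zero) , inj₁ refl
  cover-covers (inj₁ (i , suc zero))       = inj₁ (i , suc zero) , inj₁ refl
  cover-covers (inj₁ (i , suc (suc zero))) = inj₁ (i , zero) , inj₂ refl
  cover-covers (inj₂ j)                    = inj₂ j , inj₁ refl

  module _ (C : Vertex → Set) (covered : ∀ e → ∃ λ w → C w × Ends w e) where

    TwoCorners : Fin t → Set
    TwoCorners i = ∃ λ (corner : Fin 2 → Fin 3) → Injective _≡_ _≡_ corner × ∀ k → C (inj₁ (i , corner k))

    twoCorners-of : ∀ {i} k k′ → k ≢ k′ → C (inj₁ (i , k)) → C (inj₁ (i , k′)) → TwoCorners i
    twoCorners-of k k′ k≢k′ Ck Ck′ = corner , corner-injective , λ where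
        zero       → Ck
        (suc zero) → Ck′
      where
      corner : Fin 2 → Fin 3
      corner zero       = k
      corner (suc zero) = k′

      corner-injective : Injective _≡_ _≡_ corner
      corner-injective {zero}     {zero}     _  = refl
      corner-injective {zero}     {suc zero} eq = ⊥-elim (k≢k′ eq)
      corner-injective {suc zero} {zero}     eq = ⊥-elim (k≢k′ (sym eq))
      corner-injective {suc zero} {suc zero} _  = refl

    -- C contains an end of edge 0 of the triangle; a second corner comes from edge 1 if
    -- that end is corner 0, and from edge 2 if it is corner 1.
    twoCorners : ∀ i → TwoCorners i
    twoCorners i with covered (inj₁ (i , zero))
    ... | _ , C₀ , inj₁ refl with covered (inj₁ (i , suc zero))
    ...   | _ , C₁ , inj₁ refl = twoCorners-of zero (suc zero) (λ ()) C₀ C₁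
    ...   | _ , C₂ , inj₂ refl = twoCorners-of zero (suc (suc zero)) (λ ()) C₀ C₂
    twoCorners i | _ , C₁ , inj₂ refl with covered (inj₁ (i , suc (suc zero)))
    ...   | _ , C₂ , inj₁ refl = twoCorners-of (suc zero) (suc (suc zero)) (λ ()) C₁ C₂
    ...   | _ , C₀ , inj₂ refl = twoCorners-of (suc zero) zero (λ ()) C₁ C₀

    endpoint : ∀ j → ∃ λ k → C (inj₂ (j , k))
    endpoint j with covered (inj₂ j)
    ... | _ , C₀ , inj₁ refl = zero , C₀
    ... | _ , C₁ , inj₂ refl = suc zero , C₁

    chosen : CoverIndex → Vertex
    chosen (inj₁ (i , k)) = inj₁ (i , proj₁ (twoCorners i) k)
    chosen (inj₂ j)       = inj₂ (j , proj₁ (endpoint j))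

    chosen-injective : Injective _≡_ _≡_ chosen
    chosen-injective {inj₁ (i , k)} {inj₁ (i′ , k′)} eq
      with refl ← ,-injectiveˡ (inj₁-injective eq) =
      cong (λ k → inj₁ (i , k)) (proj₁ (proj₂ (twoCorners i)) (,-injectiveʳ (inj₁-injective eq)))
    chosen-injective {inj₂ j} {inj₂ j′} eq = cong inj₂ (,-injectiveˡ (inj₂-injective eq))

    chosen-∈ : ∀ c → C (chosen c)
    chosen-∈ (inj₁ (i , k)) = proj₂ (proj₂ (twoCorners i)) k
    chosen-∈ (inj₂ j)       = proj₂ (endpoint j)

  vertexCoverNumber-graph : VertexCoverNumberIs graph (t * 2 + u)
  vertexCoverNumber-graph =
    vertexCoverNumber presentation CoverIndex (↔-trans +↔⊎ (*↔× ⊎-↔ ↔-refl))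
      cover cover-injective cover-covers λ C covered → chosen C covered , chosen-injective C covered , chosen-∈ C covered

  incident : ∀ w → ∃ λ e → Ends w e
  incident (inj₁ (i , k))        = inj₁ (i , k) , inj₁ refl
  incident (inj₂ (j , zero))     = inj₂ j , inj₁ refl
  incident (inj₂ (j , suc zero)) = inj₂ j , inj₂ refl

  dilation-Γ₁ : (D : Dilation graph) → InΓ₁ D →
                MatchingNumberIs (dilHyp D) (t + u) × DomNumberIs (dilHyp D) (t * 2 + u)
  dilation-Γ₁ D Γ₁ =
    matchingNumber-dilHyp D matchingNumber-graph ,
    domNumber-dilHyp-Γ₁ D (noIsolatedVertex presentation incident) vertexCoverNumber-graph Γ₁

-- Windmills

module Windmill (m : ℕ) where

  Vertex : Set
  Vertex = Fin 1 ⊎ (Fin (suc m) × Fin 2)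

  Edge : Set
  Edge = Fin (suc m) × Fin 3

  hub : Vertex
  hub = inj₁ zero

  source target : Edge → Vertex
  source (i , zero)           = hub
  source (i , suc zero)       = hub
  source (i , suc (suc zero)) = inj₂ (i , zero)
  target (i , zero)           = inj₂ (i , zero)
  target (i , suc zero)       = inj₂ (i , suc zero)
  target (i , suc (suc zero)) = inj₂ (i , suc zero)

  between : Vertex → Vertex → Edge
  between (inj₁ _)       (inj₁ _)       = zero , zero
  between (inj₁ _)       (inj₂ (i , k)) = i , inject₁ k
  between (inj₂ (i , k)) (inj₁ _)       = i , inject₁ k
  between (inj₂ (i , _)) (inj₂ _)       = i , suc (suc zero)

  between-source-target : ∀ e → between (source e) (target e) ≡ e
  between-source-target (i , zero)           = refl
  between-source-target (i , suc zero)       = refl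
  between-source-target (i , suc (suc zero)) = refl

  between-target-source : ∀ e → between (target e) (source e) ≡ e
  between-target-source (i , zero)           = refl
  between-target-source (i , suc zero)       = refl
  between-target-source (i , suc (suc zero)) = refl

  presentation : Presentation
  presentation = record
    { Vertex        = Vertex
    ; Edge          = Edge
    ; enumVertex    = ↔-trans +↔⊎ (↔-refl ⊎-↔ *↔×)
    ; enumEdge      = *↔×
    ; source        = source
    ; target        = target
    ; source≢target = λ where
        (_ , zero) ()
        (_ , suc zero) ()
        (_ , suc (suc zero)) ()
    ; distinctEnds  = distinctEnds-byDecoder source target between between-source-target between-target-source
    }

  open Presentation presentation public using (graph)
  open Presentation presentation using (Ends; Meet)

  sameBlade⇒Meet : ∀ e f → proj₁ e ≡ proj₁ f → e ≢ f → Meet e f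
  sameBlade⇒Meet (_ , zero)           (_ , zero)           refl e≢f = ⊥-elim (e≢f refl)
  sameBlade⇒Meet (_ , suc zero)       (_ , suc zero)       refl e≢f = ⊥-elim (e≢f refl)
  sameBlade⇒Meet (_ , suc (suc zero)) (_ , suc (suc zero)) refl e≢f = ⊥-elim (e≢f refl)
  sameBlade⇒Meet (_ , zero)           (_ , suc zero)       refl _   = _ , inj₁ refl , inj₁ refl
  sameBlade⇒Meet (_ , suc zero)       (_ , zero)           refl _   = _ , inj₁ refl , inj₁ refl
  sameBlade⇒Meet (_ , zero)           (_ , suc (suc zero)) refl _   = _ , inj₂ refl , inj₁ refl
  sameBlade⇒Meet (_ , suc (suc zero)) (_ , zero)           refl _   = _ , inj₁ refl , inj₂ refl
  sameBlade⇒Meet (_ , suc zero)       (_ , suc (suc zero)) refl _   = _ , inj₂ refl , inj₂ refl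
  sameBlade⇒Meet (_ , suc (suc zero)) (_ , suc zero)       refl _   = _ , inj₂ refl , inj₂ refl

  rim : Fin (suc m) → Edge
  rim i = i , suc (suc zero)

  rims-apart : ∀ i j → i ≢ j → ¬ Meet (rim i) (rim j)
  rims-apart i j i≢j (_ , inj₁ refl , inj₁ refl) = i≢j refl
  rims-apart i j i≢j (_ , inj₂ refl , inj₂ refl) = i≢j refl

  matchingNumber-graph : GraphMatchingNumberIs graph (suc m)
  matchingNumber-graph =
    matchingNumber presentation (Fin (suc m)) ↔-refl proj₁ rim (λ _ → refl) sameBlade⇒Meet rims-apart

  hub-universal : ∀ w → ∃ λ e → Ends hub e × Ends w e
  hub-universal (inj₁ zero)           = (zero , zero) , inj₁ refl , inj₁ refl
  hub-universal (inj₂ (i , zero))     = (i , zero) , inj₁ refl , inj₂ refl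
  hub-universal (inj₂ (i , suc zero)) = (i , suc zero) , inj₁ refl , inj₂ refl

  dilation-Γ₀ : (D : Dilation graph) → InΓ₀ D →
                MatchingNumberIs (dilHyp D) (suc m) × DomNumberIs (dilHyp D) 1
  dilation-Γ₀ D Γ₀ =
    matchingNumber-dilHyp D matchingNumber-graph ,
    domNumber-dilHyp-Γ₀ D _ (universalVertex presentation hub hub-universal) Γ₀

t*2+1≡2*[1+t]∸1 : ∀ t → t * 2 + 1 ≡ 2 * suc t ∸ 1
t*2+1≡2*[1+t]∸1 t = begin
  t * 2 + 1      ≡⟨ +-comm (t * 2) 1 ⟩
  suc (t * 2)    ≡⟨ cong suc (*-comm t 2) ⟩
  suc (2 * t)    ≡⟨ cong (_∸ 1) (sym (*-suc 2 t)) ⟩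
  2 * suc t ∸ 1  ∎
  where open ≡-Reasoning

lemma4 : ∀ (n : ℕ) → 2 ≤ n →
    (∃ λ (G : Graph) → ∀ (D : Dilation G) → InΓ₁ D →
        MatchingNumberIs (dilHyp D) n × DomNumberIs (dilHyp D) (suc n)) ×
    (∃ λ (G : Graph) → ∀ (D : Dilation G) → InΓ₁ D →
        MatchingNumberIs (dilHyp D) n × DomNumberIs (dilHyp D) (2 * n ∸ 1)) ×
    (∃ λ (G : Graph) → ∀ (D : Dilation G) → InΓ₀ D →
        MatchingNumberIs (dilHyp D) n × DomNumberIs (dilHyp D) 1)
lemma4 (suc zero) (s≤s ())
lemma4 (suc (suc n′)) _ =
  (TrianglesAndEdges.graph 1 (suc n′) , TrianglesAndEdges.dilation-Γ₁ 1 (suc n′)) ,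
  (TrianglesAndEdges.graph (suc n′) 1 , λ D Γ₁ →
    subst₂ (λ ν γ → MatchingNumberIs (dilHyp D) ν × DomNumberIs (dilHyp D) γ)
      (+-comm (suc n′) 1) (t*2+1≡2*[1+t]∸1 (suc n′))
      (TrianglesAndEdges.dilation-Γ₁ (suc n′) 1 D Γ₁)) ,
  (Windmill.graph (suc n′) , Windmill.dilation-Γ₀ (suc n′))
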